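{- Let $K$ be a finite Eulerian poset with rank function $\rho$, and let $P\in \mathrm{Or}(K)$ be a projection. Then $\mathrm{Im}(P)$, as an induced subposet of $K$, is graded with rank function (the restriction of) $\rho$.
   Context: A finite poset $K$ is graded if it has a minimum $\hat 0$, a maximum $\hat 1$ and a rank function $\rho:K\to\mathbb N$ (so $\rho(y)=\rho(x)+1$ whenever $y$ covers $x$). It is Eulerian if it is graded and its Möbius function satisfies $\mu_K(x,y)=(-1)^{\rho(y)-\rho(x)}$ for all $x\leqslant y$. $\mathrm{Or}(K)$ is the monoid (under composition) of functions $f:K\to K$ that are order preserving and regressive ($f(x)\leqslant x$ for all $x$). For $f:K\to K$ and $y\in K$, $f_y:=\{x\in K: f(x)=y\}$ and $\mathrm{Im}(f)$ is the image. An idempotent $P\in\mathrm{Or}(K)$ is a projection if for all $x,y\in\mathrm{Im}(P)$ with $x\leqslant y$ the set $[x,y]\cap P_x$ is an interval $[a,b]=\{z: a\leqslant z\leqslant b\}$ of $K$. -}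

module Defs where

open import Data.Nat using (ℕ; zero; suc; _∸_; _+_)
open import Data.Fin using (Fin)
open import Data.Integer using (ℤ; 0ℤ; 1ℤ; -_) renaming (_+_ to _+ℤ_)
open import Data.List using (List; foldr; filter)
open import Data.List.Base using (allFin)
open import Data.Product using (Σ; _×_; _,_; ∃; ∃₂)
open import Relation.Nullary using (¬_; Dec; yes; no)
open import Relation.Nullary.Decidable using (_×-dec_; ¬?)
open import Relation.Binary.PropositionalEquality using (_≡_)
open import Relation.Binary.Structures using (IsPartialOrder)
open import Data.Fin.Properties using (_≟_)

record FinPoset : Set₁ where
  field
    n    : ℕ
    _≤_  : Fin n → Fin n → Set
    _≤?_ : (x y : Fin n) → Dec (x ≤ y)
    isPartialOrder : IsPartialOrder _≡_ _≤_

  Carrier : Set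
  Carrier = Fin n

  _<_ : Carrier → Carrier → Set
  x < y = x ≤ y × ¬ (x ≡ y)

  _<?_ : (x y : Carrier) → Dec (x < y)
  x <? y = (x ≤? y) ×-dec ¬? (x ≟ y)

  _⋖_ : Carrier → Carrier → Set
  x ⋖ y = x < y × (∀ z → ¬ (x < z × z < y))

  IsGradedBy : (Carrier → ℕ) → Set
  IsGradedBy ρ =
    (Σ Carrier λ bot → ∀ x → bot ≤ x) ×
    (Σ Carrier λ top → ∀ x → x ≤ top) ×
    (∀ x y → x ⋖ y → ρ y ≡ suc (ρ x))

  sumHalfOpen : Carrier → Carrier → (Carrier → ℤ) → ℤ
  sumHalfOpen x y g =
    foldr (λ z acc → g z +ℤ acc) 0ℤ
      (filter (λ z → (x ≤? z) ×-dec (z <? y)) (allFin n))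

  -- The recursion is unfolded with a fuel parameter; fuel n suffices since
  -- every chain in a poset on n elements has fewer than n strict steps.
  μ-fuel : ℕ → Carrier → Carrier → ℤ
  μ-fuel zero    x y = 0ℤ
  μ-fuel (suc k) x y with x ≟ y | x ≤? y
  ... | yes _ | _     = 1ℤ
  ... | no _  | yes _ = - sumHalfOpen x y (μ-fuel k x)
  ... | no _  | no _  = 0ℤ

  μ : Carrier → Carrier → ℤ
  μ = μ-fuel (suc n)

sign : ℕ → ℤ
sign zero    = 1ℤ
sign (suc k) = - sign k

module _ (K : FinPoset) where
  open FinPoset K

  IsEulerian : (Carrier → ℕ) → Set
  IsEulerian ρ = IsGradedBy ρ × (∀ x y → x ≤ y → μ x y ≡ sign (ρ y ∸ ρ x))

  IsOr : (Carrier → Carrier) → Set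
  IsOr f = (∀ x y → x ≤ y → f x ≤ f y) × (∀ x → f x ≤ x)

  InIm : (Carrier → Carrier) → Carrier → Set
  InIm f x = Σ Carrier λ w → f w ≡ x

  IsProjection : (Carrier → Carrier) → Set
  IsProjection P =
    IsOr P × (∀ x → P (P x) ≡ P x) ×
    (∀ x y → InIm P x → InIm P y → x ≤ y →
      ∃₂ λ a b → ∀ z → ((x ≤ z × z ≤ y × P z ≡ x) → (a ≤ z × z ≤ b))
                      × ((a ≤ z × z ≤ b) → (x ≤ z × z ≤ y × P z ≡ x)))

  ImGradedBy : (Carrier → Carrier) → (Carrier → ℕ) → Set
  ImGradedBy P ρ =
    (Σ Carrier λ bot → InIm P bot × (∀ x → InIm P x → bot ≤ x)) ×
    (Σ Carrier λ top → InIm P top × (∀ x → InIm P x → x ≤ top)) ×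
    (∀ x y → InIm P x → InIm P y → x < y →
      (∀ z → InIm P z → ¬ (x < z × z < y)) → ρ y ≡ suc (ρ x))

module Submission where

-- Let x < y be adjacent in Im(P). For x ≤ z < y we have x = P x ≤ P z ≤ z < y with P z in the
-- image, so P z = x: the half-open interval [x,y) lies in the fibre of x, which P being a
-- projection makes an interval [a,b]. Hence [x,y) has a largest element b. If b = x, then y
-- covers x in K and ρ y = ρ x + 1. Otherwise the defining recursion of the Möbius function gives
-- μ(x,y) = -(Σ_{x ≤ z < b} μ(x,z) + μ(x,b)) = 0, impossible in an Eulerian poset.

open import Defs
open import Data.Nat using (ℕ; suc; _∸_) renaming (_<_ to _<ℕ_)
import Data.Nat.Properties as ℕ
open import Data.Fin.Properties using (_≟_)
open import Data.Integer using (ℤ; 0ℤ; -_) renaming (_+_ to _+ℤ_)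
import Data.Integer.Properties as ℤ
open import Data.List using (List; []; _∷_; foldr; filter; length; allFin)
open import Data.List.Properties using (filter-accept; filter-reject; filter-notAll; filter-≐; length-tabulate)
open import Data.List.Relation.Unary.All as All using (All; []; _∷_)
open import Data.List.Relation.Unary.All.Properties using (all-filter)
open import Data.List.Relation.Unary.Any as Any using (here; there)
open import Data.List.Relation.Unary.Unique.Propositional using (Unique; []; _∷_)
open import Data.List.Relation.Unary.Unique.Propositional.Properties using (allFin⁺)
open import Data.List.Membership.Propositional using (_∈_)
open import Data.List.Membership.Propositional.Properties using (∈-allFin; ∈-filter⁺)
open import Data.Product using (Σ; _×_; _,_; proj₁; proj₂)
open import Data.Sum using (_⊎_; inj₁; inj₂; [_,_])
open import Data.Empty using (⊥-elim)
open import Function using (_∘_)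
open import Relation.Nullary using (¬_; Dec; yes; no; contradiction)
open import Relation.Nullary.Decidable using (_×-dec_; _⊎-dec_)
open import Relation.Unary using (Pred; Decidable; _⊆_; _≐_)
open import Relation.Binary.Definitions using (DecidableEquality)
open import Relation.Binary.Structures using (IsPartialOrder)
open import Relation.Binary.PropositionalEquality
  using (_≡_; _≢_; refl; sym; trans; cong; cong₂; subst; module ≡-Reasoning)

module _ {a} {A : Set a} where

  sumBy : (A → ℤ) → List A → ℤ
  sumBy g = foldr (λ z acc → g z +ℤ acc) 0ℤ

  sumBy-cong : ∀ {g h : A → ℤ} {l} → All (λ z → g z ≡ h z) l → sumBy g l ≡ sumBy h l
  sumBy-cong []       = refl
  sumBy-cong (e ∷ es) = cong₂ _+ℤ_ e (sumBy-cong es)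

  filter-filter-⊆ : ∀ {p q} {P : Pred A p} {Q : Pred A q} (P? : Decidable P) (Q? : Decidable Q) →
    P ⊆ Q → ∀ l → filter P? (filter Q? l) ≡ filter P? l
  filter-filter-⊆ P? Q? P⊆Q []      = refl
  filter-filter-⊆ P? Q? P⊆Q (x ∷ l) with Q? x
  ... | no ¬Qx = trans (filter-filter-⊆ P? Q? P⊆Q l) (sym (filter-reject P? (¬Qx ∘ P⊆Q)))
  ... | yes _ with P? x
  ...   | yes _ = cong (x ∷_) (filter-filter-⊆ P? Q? P⊆Q l)
  ...   | no _  = filter-filter-⊆ P? Q? P⊆Q l

  length-filter-< : ∀ {p} {P : Pred A p} (P? : Decidable P) {x l} →
    x ∈ l → ¬ P x → length (filter P? l) <ℕ length l
  length-filter-< P? x∈l ¬Px = filter-notAll P? _ (Any.map (λ { refl → ¬Px }) x∈l)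

  module _ (_≟_ : DecidableEquality A) {p} {P : Pred A p} (P? : Decidable P) where

    filter-∪-absent : ∀ {b l} → All (b ≢_) l →
      filter (λ z → P? z ⊎-dec z ≟ b) l ≡ filter P? l
    filter-∪-absent [] = refl
    filter-∪-absent {b} {w ∷ l} (b≢w ∷ b∉l) = by-cases (P? w)
      where
      P∪b? = λ z → P? z ⊎-dec z ≟ b
      by-cases : Dec (P w) → filter P∪b? (w ∷ l) ≡ filter P? (w ∷ l)
      by-cases (yes Pw) = begin
        filter P∪b? (w ∷ l)  ≡⟨ filter-accept P∪b? (inj₁ Pw) ⟩
        w ∷ filter P∪b? l    ≡⟨ cong (w ∷_) (filter-∪-absent b∉l) ⟩
        w ∷ filter P? l      ≡⟨ filter-accept P? Pw ⟨
        filter P? (w ∷ l)    ∎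
        where open ≡-Reasoning
      by-cases (no ¬Pw) = begin
        filter P∪b? (w ∷ l)  ≡⟨ filter-reject P∪b? [ ¬Pw , b≢w ∘ sym ] ⟩
        filter P∪b? l        ≡⟨ filter-∪-absent b∉l ⟩
        filter P? l          ≡⟨ filter-reject P? ¬Pw ⟨
        filter P? (w ∷ l)    ∎
        where open ≡-Reasoning

    sumBy-filter-insert : ∀ (g : A → ℤ) {b l} → Unique l → b ∈ l → ¬ P b →
      sumBy g (filter (λ z → P? z ⊎-dec z ≟ b) l) ≡ sumBy g (filter P? l) +ℤ g b
    sumBy-filter-insert g {b} {b ∷ l} (b∉l ∷ _) (here refl) ¬Pb = begin
      sumBy g (filter P∪b? (b ∷ l))      ≡⟨ cong (sumBy g) (filter-accept P∪b? (inj₂ refl)) ⟩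
      g b +ℤ sumBy g (filter P∪b? l)     ≡⟨ cong (λ s → g b +ℤ sumBy g s) (filter-∪-absent b∉l) ⟩
      g b +ℤ sumBy g (filter P? l)       ≡⟨ ℤ.+-comm (g b) _ ⟩
      sumBy g (filter P? l) +ℤ g b       ≡⟨ cong (λ s → sumBy g s +ℤ g b) (filter-reject P? ¬Pb) ⟨
      sumBy g (filter P? (b ∷ l)) +ℤ g b ∎
      where
      open ≡-Reasoning
      P∪b? = λ z → P? z ⊎-dec z ≟ b
    sumBy-filter-insert g {b} {w ∷ l} (w∉l ∷ u) (there b∈l) ¬Pb = by-cases (P? w)
      where
      open ≡-Reasoning
      P∪b? = λ z → P? z ⊎-dec z ≟ b
      by-cases : Dec (P w) → sumBy g (filter P∪b? (w ∷ l)) ≡ sumBy g (filter P? (w ∷ l)) +ℤ g b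
      by-cases (yes Pw) = begin
        sumBy g (filter P∪b? (w ∷ l))           ≡⟨ cong (sumBy g) (filter-accept P∪b? (inj₁ Pw)) ⟩
        g w +ℤ sumBy g (filter P∪b? l)          ≡⟨ cong (g w +ℤ_) (sumBy-filter-insert g u b∈l ¬Pb) ⟩
        g w +ℤ (sumBy g (filter P? l) +ℤ g b)   ≡⟨ ℤ.+-assoc (g w) _ _ ⟨
        sumBy g (w ∷ filter P? l) +ℤ g b        ≡⟨ cong (λ s → sumBy g s +ℤ g b) (filter-accept P? Pw) ⟨
        sumBy g (filter P? (w ∷ l)) +ℤ g b      ∎
      by-cases (no ¬Pw) = begin
        sumBy g (filter P∪b? (w ∷ l))      ≡⟨ cong (sumBy g) (filter-reject P∪b? [ ¬Pw , All.lookup w∉l b∈l ]) ⟩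
        sumBy g (filter P∪b? l)            ≡⟨ sumBy-filter-insert g u b∈l ¬Pb ⟩
        sumBy g (filter P? l) +ℤ g b       ≡⟨ cong (λ s → sumBy g s +ℤ g b) (filter-reject P? ¬Pw) ⟨
        sumBy g (filter P? (w ∷ l)) +ℤ g b ∎

sign≢0 : ∀ k → sign k ≢ 0ℤ
sign≢0 (suc k) -s≡0 = sign≢0 k (ℤ.neg-injective -s≡0)

module _ (K : FinPoset) where
  open FinPoset K
  open IsPartialOrder isPartialOrder using ()
    renaming (refl to ≤-refl; trans to ≤-trans; antisym to ≤-antisym)

  <-irrefl : ∀ {x} → ¬ x < x
  <-irrefl (_ , x≢x) = x≢x refl

  <-≤-trans : ∀ {x y z} → x < y → y ≤ z → x < z
  <-≤-trans (x≤y , x≢y) y≤z = ≤-trans x≤y y≤z , λ { refl → x≢y (≤-antisym x≤y y≤z) }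

  ≤-<-trans : ∀ {x y z} → x ≤ y → y < z → x < z
  ≤-<-trans x≤y (y≤z , y≢z) = ≤-trans x≤y y≤z , λ { refl → y≢z (≤-antisym y≤z x≤y) }

  height : Carrier → ℕ
  height z = length (filter (_<? z) (allFin n))

  height-mono : ∀ {w z} → w < z → height w <ℕ height z
  height-mono {w} {z} w<z = subst (λ l → length l <ℕ height z)
    (filter-filter-⊆ (_<? w) (_<? z) (λ v<w → <-≤-trans v<w (proj₁ w<z)) (allFin n))
    (length-filter-< (_<? w) (∈-filter⁺ (_<? z) (∈-allFin w) w<z) <-irrefl)

  height<n : ∀ z → height z <ℕ n
  height<n z = subst (height z <ℕ_) (length-tabulate (λ i → i))
    (length-filter-< (_<? z) (∈-allFin z) <-irrefl)

  μ-fuel-irrelevant : ∀ {k m} x z → height z <ℕ k → height z <ℕ m → μ-fuel k x z ≡ μ-fuel m x z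
  μ-fuel-irrelevant {suc k} {suc m} x z hk hm with x ≟ z | x ≤? z
  ... | yes _ | _     = refl
  ... | no _  | no _  = refl
  ... | no _  | yes _ = cong -_ (sumBy-cong (All.map fuel-enough (all-filter _ (allFin n))))
    where
    fuel-enough : ∀ {w} → x ≤ w × w < z → μ-fuel k x w ≡ μ-fuel m x w
    fuel-enough {w} (_ , w<z) = μ-fuel-irrelevant x w
      (ℕ.<-≤-trans (height-mono w<z) (ℕ.≤-pred hk)) (ℕ.<-≤-trans (height-mono w<z) (ℕ.≤-pred hm))

  μ-unfold : ∀ k {x y} → x ≢ y → x ≤ y → μ-fuel (suc k) x y ≡ - sumHalfOpen x y (μ-fuel k x)
  μ-unfold k {x} {y} x≢y x≤y with x ≟ y | x ≤? y
  ... | yes x≡y | _       = contradiction x≡y x≢y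
  ... | no _    | no x≰y  = contradiction x≤y x≰y
  ... | no _    | yes _   = refl

  μ-fuel-n≡μ : ∀ x z → μ-fuel n x z ≡ μ x z
  μ-fuel-n≡μ x z = μ-fuel-irrelevant x z (height<n z) (ℕ.m<n⇒m<1+n (height<n z))

  μ-vanishes-if-halfOpen-has-top : ∀ {x y b} → x ≤ b → x ≢ b → b < y →
    (∀ z → x ≤ z → z < y → z ≤ b) → μ x y ≡ 0ℤ
  μ-vanishes-if-halfOpen-has-top {x} {y} {b} x≤b x≢b b<y top = begin
    μ x y
      ≡⟨ μ-unfold n (proj₂ x<y) (proj₁ x<y) ⟩
    - sumBy g (filter inXy? all)
      ≡⟨ cong (λ l → - sumBy g l) (filter-≐ inXy? inXb∪b? halfOpen-split all) ⟩
    - sumBy g (filter inXb∪b? all)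
      ≡⟨ cong -_ (sumBy-filter-insert _≟_ inXb? g (allFin⁺ n) (∈-allFin b) b-not-below-b) ⟩
    - (S +ℤ g b)
      ≡⟨ cong (λ t → - (S +ℤ t)) (trans (μ-fuel-n≡μ x b) (μ-unfold n x≢b x≤b)) ⟩
    - (S +ℤ - S)
      ≡⟨ cong -_ (ℤ.+-inverseʳ S) ⟩
    0ℤ ∎
    where
    open ≡-Reasoning
    all = allFin n
    g = μ-fuel n x
    x<y = ≤-<-trans x≤b b<y
    inXy? = λ z → (x ≤? z) ×-dec (z <? y)
    inXb? = λ z → (x ≤? z) ×-dec (z <? b)
    inXb∪b? = λ z → inXb? z ⊎-dec z ≟ b
    b-not-below-b : ¬ (x ≤ b × b < b)
    b-not-below-b = <-irrefl ∘ proj₂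
    S = sumHalfOpen x b g
    halfOpen-split : (λ z → x ≤ z × z < y) ≐ (λ z → (x ≤ z × z < b) ⊎ z ≡ b)
    halfOpen-split = split , join
      where
      split : ∀ {z} → x ≤ z × z < y → (x ≤ z × z < b) ⊎ z ≡ b
      split {z} (x≤z , z<y) with z ≟ b
      ... | yes z≡b = inj₂ z≡b
      ... | no z≢b  = inj₁ (x≤z , top z x≤z z<y , z≢b)
      join : ∀ {z} → (x ≤ z × z < b) ⊎ z ≡ b → x ≤ z × z < y
      join (inj₁ (x≤z , z<b)) = x≤z , <-≤-trans z<b (proj₁ b<y)
      join (inj₂ refl)        = x≤b , b<y

module Projection (K : FinPoset) {P : FinPoset.Carrier K → FinPoset.Carrier K}
                  (isProjection : IsProjection K P) where
  open FinPoset K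
  open IsPartialOrder isPartialOrder using ()
    renaming (refl to ≤-refl; trans to ≤-trans; antisym to ≤-antisym)

  private
    P-mono : ∀ x y → x ≤ y → P x ≤ P y
    P-mono = proj₁ (proj₁ isProjection)

    P-regressive : ∀ x → P x ≤ x
    P-regressive = proj₂ (proj₁ isProjection)

  image-fixed : ∀ {x} → InIm K P x → P x ≡ x
  image-fixed (w , refl) = proj₁ (proj₂ isProjection) w

  image-bottom : (Σ Carrier λ bot → ∀ x → bot ≤ x) →
    Σ Carrier λ bot → InIm K P bot × (∀ x → InIm K P x → bot ≤ x)
  image-bottom (bot , bot≤) =
    P bot , (bot , refl) , λ x x∈Im → subst (P bot ≤_) (image-fixed x∈Im) (P-mono bot x (bot≤ x))

  image-top : (Σ Carrier λ top → ∀ x → x ≤ top) →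
    Σ Carrier λ top → InIm K P top × (∀ x → InIm K P x → x ≤ top)
  image-top (top , ≤top) =
    P top , (top , refl) , λ x x∈Im → subst (_≤ P top) (image-fixed x∈Im) (P-mono x top (≤top x))

  module ImageGap {x y} (x∈Im : InIm K P x) (y∈Im : InIm K P y) (x<y : x < y)
                  (gap : ∀ z → InIm K P z → ¬ (x < z × z < y)) where

    halfOpen⊆fiber : ∀ z → x ≤ z → z < y → P z ≡ x
    halfOpen⊆fiber z x≤z z<y with P z ≟ x | P z ≟ y
    ... | yes Pz≡x | _        = Pz≡x
    ... | no _     | yes Pz≡y =
      contradiction (≤-antisym (proj₁ z<y) (subst (_≤ z) Pz≡y (P-regressive z))) (proj₂ z<y)
    ... | no Pz≢x  | no Pz≢y  = ⊥-elim (gap (P z) (z , refl)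
      ( (subst (_≤ P z) (image-fixed x∈Im) (P-mono x z x≤z) , Pz≢x ∘ sym)
      , (≤-trans (P-regressive z) (proj₁ z<y) , Pz≢y)))

    halfOpen-top : Σ Carrier λ b → x ≤ b × b < y × (∀ z → x ≤ z → z < y → z ≤ b)
    halfOpen-top with proj₂ (proj₂ isProjection) x y x∈Im y∈Im (proj₁ x<y)
    ... | a , b , fiber≐[a,b] = b , x≤b , b<y , below-b
      where
      x∈[a,b] : a ≤ x × x ≤ b
      x∈[a,b] = proj₁ (fiber≐[a,b] x) (≤-refl , proj₁ x<y , image-fixed x∈Im)
      x≤b = proj₂ x∈[a,b]
      b∈fiber : x ≤ b × b ≤ y × P b ≡ x
      b∈fiber = proj₂ (fiber≐[a,b] b) (≤-trans (proj₁ x∈[a,b]) x≤b , ≤-refl)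
      b<y : b < y
      b<y = proj₁ (proj₂ b∈fiber) ,
            λ { refl → proj₂ x<y (trans (sym (proj₂ (proj₂ b∈fiber))) (image-fixed y∈Im)) }
      below-b : ∀ z → x ≤ z → z < y → z ≤ b
      below-b z x≤z z<y = proj₂ (proj₁ (fiber≐[a,b] z) (x≤z , proj₁ z<y , halfOpen⊆fiber z x≤z z<y))

  image-cover : (ρ : Carrier → ℕ) → (∀ x y → x ⋖ y → ρ y ≡ suc (ρ x)) →
    (∀ x y → x ≤ y → μ x y ≡ sign (ρ y ∸ ρ x)) →
    ∀ x y → InIm K P x → InIm K P y → x < y →
    (∀ z → InIm K P z → ¬ (x < z × z < y)) → ρ y ≡ suc (ρ x)
  image-cover ρ cover eulerian x y x∈Im y∈Im x<y gap
    with ImageGap.halfOpen-top x∈Im y∈Im x<y gap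
  ... | b , x≤b , b<y , top with x ≟ b
  ...   | yes refl = cover x y (x<y , λ z (x<z , z<y) →
                       <-irrefl K (<-≤-trans K x<z (top z (proj₁ x<z) z<y)))
  ...   | no x≢b   = ⊥-elim (sign≢0 (ρ y ∸ ρ x) (begin
      sign (ρ y ∸ ρ x) ≡⟨ eulerian x y (proj₁ x<y) ⟨
      μ x y            ≡⟨ μ-vanishes-if-halfOpen-has-top K x≤b x≢b b<y top ⟩
      0ℤ               ∎))
    where open ≡-Reasoning

theorem4p11 : (K : FinPoset) (ρ : FinPoset.Carrier K → ℕ) →
    IsEulerian K ρ → (P : FinPoset.Carrier K → FinPoset.Carrier K) →
    IsProjection K P → ImGradedBy K P ρ
theorem4p11 K ρ ((has-bot , has-top , cover) , eulerian) P isProjection =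
  image-bottom has-bot , image-top has-top , image-cover ρ cover eulerian
  where open Projection K isProjection
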